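{- Let $t$ be a positive integer with $t\equiv \mathfrak t\pmod{2730}$ for some $\mathfrak t\in\{1369,2599\}$. Then $659_2^{(2;t)}=659\cdot(2^{12t}-1)/(2^{12}-1)$ is a Riesel number.
   Context: For integers $b\ge2$, $k\ge1$, $t\ge1$ and $z\ge0$, the $b$-repstring is $k_b^{(z;t)}=k\,(b^{(z+\ell)t}-1)/(b^{z+\ell}-1)$ where $\ell=\lfloor\log_b k\rfloor+1$; for $k=659$, $b=2$ one has $\ell=10$. A Riesel number is an odd positive integer $k$ such that $k\cdot 2^n-1$ is composite for all positive integers $n$. -}

module Defs where

open import Data.Nat.Base using (ℕ; suc; _+_; _*_; _^_; _∸_; _/_)
open import Data.Nat.Logarithm using (⌊log₂_⌋)
open import Data.Nat.Divisibility using (_∣_)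
open import Data.Nat.Primality using (Composite)
open import Data.Product using (_×_)
open import Relation.Nullary using (¬_)

digits₂ : ℕ → ℕ
digits₂ k = suc ⌊log₂ k ⌋

-- binary repstring  k₂^(z;t) = k (2^((z+ℓ)t) - 1) / (2^(z+ℓ) - 1).
-- The denominator 2^(z+ℓ) - 1 is written as suc (2^(z+ℓ) ∸ 2), which is equal
-- to it because z + ℓ ≥ 1 (so 2^(z+ℓ) ≥ 2); this form makes the divisor
-- syntactically nonzero. The division is exact.
repstring₂ : (k z t : ℕ) → ℕ
repstring₂ k z t =
  (k * (2 ^ ((z + digits₂ k) * t) ∸ 1)) / suc (2 ^ (z + digits₂ k) ∸ 2)

Riesel : ℕ → Set
Riesel k = (¬ (2 ∣ k)) × ((n : ℕ) → Composite (k * 2 ^ suc n ∸ 1))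

-- With b = 2^12 = 4096, the repstring is 659·R t for the base-b repunit
-- R t = 1 + b + ⋯ + b^(t−1).  Put M = (2^24 − 1)/3 = 3·5·7·13·17·241.  Modulo M
-- the powers of 2 have period 24 and R has period 2730 = 2·3·5·7·13 (b ≡ 1 modulo
-- 3, 5, 7, 13 and b ≡ −1 modulo 17, 241), so for t ≡ 𝔱 (mod 2730) the number
-- 659·R t·2^n − 1 is congruent modulo M to 659·R 𝔱·2^(n mod 24) − 1.  For each of
-- the 24 exponents a finite computation shows that this shares a factor with M,
-- and that factor is proper because 659·R t > M.
module Submission where

open import Defs
open import Data.Nat.Base
  using (ℕ; zero; suc; _+_; _*_; _^_; _∸_; _/_; _%_; pred; _≤_; _<_; z≤n; s≤s;
         NonZero; >-nonZero; >-nonZero⁻¹; n>1⇒nonTrivial)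
open import Data.Nat.Properties
open import Data.Nat.DivMod
open import Data.Nat.Divisibility using (_∣_; hasNonTrivialDivisor; ∣-antisym; ∣n∣m%n⇒∣m; %-presˡ-∣; n∣m⇒m%n≡0)
open import Data.Nat.GCD using (gcd; gcd[m,n]∣m; gcd[m,n]∣n; gcd-greatest; gcd[m,n]≤n)
open import Data.Nat.Primality using (Composite)
open import Data.Nat.Tactic.RingSolver using (solve-∀)
open import Data.Product using (_,_)
open import Data.Sum using (_⊎_; inj₁; inj₂)
open import Relation.Nullary using (Dec; ¬_)
open import Relation.Nullary.Decidable using (from-yes)
open import Relation.Binary.PropositionalEquality using (_≡_; refl; sym; trans; cong; cong₂; subst; module ≡-Reasoning)

open ≡-Reasoning

repunit : ℕ → ℕ → ℕ
repunit b zero    = 0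
repunit b (suc t) = 1 + b * repunit b t

repunit-mono-≤ : ∀ b {s t} → s ≤ t → repunit b s ≤ repunit b t
repunit-mono-≤ b z≤n       = z≤n
repunit-mono-≤ b (s≤s s≤t) = s≤s (*-monoʳ-≤ b (repunit-mono-≤ b s≤t))

repunit-+ : ∀ b s t → repunit b (s + t) ≡ repunit b s + b ^ s * repunit b t
repunit-+ b zero    t = sym (*-identityˡ (repunit b t))
repunit-+ b (suc s) t = begin
  1 + b * repunit b (s + t)                           ≡⟨ cong (λ x → 1 + b * x) (repunit-+ b s t) ⟩
  1 + b * (repunit b s + b ^ s * repunit b t)         ≡⟨ cong suc (*-distribˡ-+ b (repunit b s) _) ⟩
  1 + (b * repunit b s + b * (b ^ s * repunit b t))   ≡⟨ cong (λ x → 1 + (b * repunit b s + x)) (sym (*-assoc b (b ^ s) _)) ⟩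
  1 + b * repunit b s + b * b ^ s * repunit b t       ∎

[1+m]^t≡1+m*repunit : ∀ m t → suc m ^ t ≡ 1 + m * repunit (suc m) t
[1+m]^t≡1+m*repunit m zero    = cong suc (sym (*-zeroʳ m))
[1+m]^t≡1+m*repunit m (suc t) = begin
  suc m * suc m ^ t                        ≡⟨ cong (suc m *_) ([1+m]^t≡1+m*repunit m t) ⟩
  suc m * (1 + m * repunit (suc m) t)      ≡⟨ expand m (repunit (suc m) t) ⟩
  1 + m * (1 + suc m * repunit (suc m) t)  ∎
  where
  expand : ∀ m x → (1 + m) * (1 + m * x) ≡ 1 + m * (1 + (1 + m) * x)
  expand = solve-∀

*[b^t∸1]/[b∸1]≡*repunit : ∀ k {b} t → 2 ≤ b → k * (b ^ t ∸ 1) / suc (b ∸ 2) ≡ k * repunit b t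
*[b^t∸1]/[b∸1]≡*repunit k {suc (suc m)} t (s≤s (s≤s z≤n)) = begin
  k * (suc (suc m) ^ t ∸ 1) / suc m    ≡⟨ cong (λ x → k * (x ∸ 1) / suc m) ([1+m]^t≡1+m*repunit (suc m) t) ⟩
  k * (suc m * R) / suc m              ≡⟨ cong (λ x → k * x / suc m) (*-comm (suc m) R) ⟩
  k * (R * suc m) / suc m              ≡⟨ cong (_/ suc m) (sym (*-assoc k R (suc m))) ⟩
  k * R * suc m / suc m                ≡⟨ m*n/n≡m (k * R) (suc m) ⟩
  k * R                                ∎
  where
  R = repunit (suc (suc m)) t

repstring₂≡*repunit : ∀ k z t → repstring₂ k z t ≡ k * repunit (2 ^ (z + digits₂ k)) t
repstring₂≡*repunit k z t = begin
  k * (2 ^ (z+ℓ * t) ∸ 1) / suc (2 ^ z+ℓ ∸ 2)    ≡⟨ cong (λ x → k * (x ∸ 1) / suc (2 ^ z+ℓ ∸ 2)) (sym (^-*-assoc 2 z+ℓ t)) ⟩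
  k * ((2 ^ z+ℓ) ^ t ∸ 1) / suc (2 ^ z+ℓ ∸ 2)    ≡⟨ *[b^t∸1]/[b∸1]≡*repunit k t (^-monoʳ-≤ 2 1≤z+ℓ) ⟩
  k * repunit (2 ^ z+ℓ) t                        ∎
  where
  z+ℓ = z + digits₂ k
  1≤z+ℓ : 1 ≤ z+ℓ
  1≤z+ℓ = ≤-trans (s≤s z≤n) (m≤n+m (digits₂ k) z)

¬2∣1+n*2 : ∀ n → ¬ 2 ∣ 1 + n * 2
¬2∣1+n*2 n 2∣ = 1+n≢0 (trans (sym ([m+kn]%n≡m%n 1 n 2)) (n∣m⇒m%n≡0 _ 2 2∣))

¬2∣[1+a*2]*repunit[b*2] : ∀ a b {t} → 0 < t → ¬ 2 ∣ (1 + a * 2) * repunit (b * 2) t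
¬2∣[1+a*2]*repunit[b*2] a b {suc t} _ =
  subst (λ x → ¬ 2 ∣ x) (sym (regroup a b (repunit (b * 2) t))) (¬2∣1+n*2 (a + (1 + a * 2) * b * repunit (b * 2) t))
  where
  regroup : ∀ a b x → (1 + a * 2) * (1 + b * 2 * x) ≡ 1 + (a + (1 + a * 2) * b * x) * 2
  regroup = solve-∀

%-+-cong : ∀ {a b c d m} .{{_ : NonZero m}} → a % m ≡ b % m → c % m ≡ d % m → (a + c) % m ≡ (b + d) % m
%-+-cong {a} {b} {c} {d} {m} a≡b c≡d = begin
  (a + c) % m                ≡⟨ %-distribˡ-+ a c m ⟩
  (a % m + c % m) % m        ≡⟨ cong₂ (λ x y → (x + y) % m) a≡b c≡d ⟩
  (b % m + d % m) % m        ≡⟨ %-distribˡ-+ b d m ⟨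
  (b + d) % m                ∎

%-*-cong : ∀ {a b c d m} .{{_ : NonZero m}} → a % m ≡ b % m → c % m ≡ d % m → (a * c) % m ≡ (b * d) % m
%-*-cong {a} {b} {c} {d} {m} a≡b c≡d = begin
  (a * c) % m                ≡⟨ %-distribˡ-* a c m ⟩
  (a % m * (c % m)) % m      ≡⟨ cong₂ (λ x y → (x * y) % m) a≡b c≡d ⟩
  (b % m * (d % m)) % m      ≡⟨ %-distribˡ-* b d m ⟨
  (b * d) % m                ∎

%-pred-cong : ∀ {x y m} .{{_ : NonZero m}} → 0 < x → 0 < y → x % m ≡ y % m → pred x % m ≡ pred y % m
%-pred-cong {suc x} {suc y} {suc m} _ _ x≡y = begin
  x % suc m              ≡⟨ shift x ⟩
  (suc x + m) % suc m    ≡⟨ %-+-cong {suc x} {suc y} {m} x≡y refl ⟩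
  (suc y + m) % suc m    ≡⟨ shift y ⟨
  y % suc m              ∎
  where
  shift : ∀ z → z % suc m ≡ (suc z + m) % suc m
  shift z = trans (sym ([m+n]%n≡m%n z (suc m))) (cong (_% suc m) (+-suc z m))

gcd-cong-% : ∀ {x y m} .{{_ : NonZero m}} → x % m ≡ y % m → gcd x m ≡ gcd y m
gcd-cong-% {m = m} x≡y = ∣-antisym (gcd∣gcd x≡y) (gcd∣gcd (sym x≡y))
  where
  gcd∣gcd : ∀ {x y} → x % m ≡ y % m → gcd x m ∣ gcd y m
  gcd∣gcd {x} {y} x≡y = gcd-greatest (∣n∣m%n⇒∣m (gcd[m,n]∣n x m) g∣y%m) (gcd[m,n]∣n x m)
    where
    g∣y%m : gcd x m ∣ y % m
    g∣y%m = subst (gcd x m ∣_) x≡y (%-presˡ-∣ (gcd[m,n]∣m x m) (gcd[m,n]∣n x m))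

1<gcd⇒composite : ∀ {x m} .{{_ : NonZero m}} → 1 < gcd x m → m < x → Composite x
1<gcd⇒composite {x} {m} 1<g m<x =
  hasNonTrivialDivisor {{n>1⇒nonTrivial 1<g}} (≤-<-trans (gcd[m,n]≤n x m) m<x) (gcd[m,n]∣m x m)

periodic⇒f[m]≡f[m%n] : ∀ {A : Set} (f : ℕ → A) n .{{_ : NonZero n}} →
                       (∀ m → f (n + m) ≡ f m) → ∀ m → f m ≡ f (m % n)
periodic⇒f[m]≡f[m%n] f n shift m = begin
  f m                        ≡⟨ cong f (m≡m%n+[m/n]*n m n) ⟩
  f (m % n + m / n * n)      ≡⟨ drop-periods (m % n) (m / n) ⟩
  f (m % n)                  ∎
  where
  drop-periods : ∀ r q → f (r + q * n) ≡ f r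
  drop-periods r zero    = cong f (+-identityʳ r)
  drop-periods r (suc q) = begin
    f (r + (n + q * n))      ≡⟨ cong f (sym (+-assoc r n (q * n))) ⟩
    f (r + n + q * n)        ≡⟨ cong (λ x → f (x + q * n)) (+-comm r n) ⟩
    f (n + r + q * n)        ≡⟨ cong f (+-assoc n r (q * n)) ⟩
    f (n + (r + q * n))      ≡⟨ shift (r + q * n) ⟩
    f (r + q * n)            ≡⟨ drop-periods r q ⟩
    f r                      ∎

^-%-periodic : ∀ b {L m} .{{_ : NonZero L}} .{{_ : NonZero m}} →
               b ^ L % m ≡ 1 % m → ∀ e → b ^ e % m ≡ b ^ (e % L) % m
^-%-periodic b {L} {m} b^L≡1 = periodic⇒f[m]≡f[m%n] (λ e → b ^ e % m) L shift
  where
  shift : ∀ e → b ^ (L + e) % m ≡ b ^ e % m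
  shift e = begin
    b ^ (L + e) % m          ≡⟨ cong (_% m) (^-distribˡ-+-* b L e) ⟩
    b ^ L * b ^ e % m        ≡⟨ %-*-cong {c = b ^ e} b^L≡1 refl ⟩
    1 * b ^ e % m            ≡⟨ cong (_% m) (*-identityˡ (b ^ e)) ⟩
    b ^ e % m                ∎

repunit-%-periodic : ∀ b {L m} .{{_ : NonZero L}} .{{_ : NonZero m}} →
                     repunit b L % m ≡ 0 % m → b ^ L % m ≡ 1 % m →
                     ∀ t → repunit b t % m ≡ repunit b (t % L) % m
repunit-%-periodic b {L} {m} R≡0 b^L≡1 = periodic⇒f[m]≡f[m%n] (λ t → repunit b t % m) L shift
  where
  shift : ∀ t → repunit b (L + t) % m ≡ repunit b t % m
  shift t = begin
    repunit b (L + t) % m                        ≡⟨ cong (_% m) (repunit-+ b L t) ⟩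
    (repunit b L + b ^ L * repunit b t) % m      ≡⟨ %-+-cong R≡0 (%-*-cong {c = repunit b t} b^L≡1 refl) ⟩
    (1 * repunit b t) % m                        ≡⟨ cong (_% m) (*-identityˡ (repunit b t)) ⟩
    repunit b t % m                              ∎

-- Phrased with gcd so that no prime factor of m has to be named; when 2^L ≡ 1
-- (mod m) it says that the prime factors of m form a covering set for k.
Covering : (m L k : ℕ) → Set
Covering m L k = ∀ {r} → r < L → 1 < gcd (k * 2 ^ r ∸ 1) m

covering? : ∀ m L k → Dec (Covering m L k)
covering? m L k = allUpTo? (λ r → 1 <? gcd (k * 2 ^ r ∸ 1) m) L

covering⇒composite : ∀ {m L k K} .{{_ : NonZero m}} .{{_ : NonZero L}} →
                     2 ^ L % m ≡ 1 % m → Covering m L k → 0 < k →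
                     K % m ≡ k % m → m < K → ∀ n → Composite (K * 2 ^ suc n ∸ 1)
covering⇒composite {m} {L} {k} {K} 2^L≡1 cover 0<k K≡k m<K n =
  1<gcd⇒composite (subst (1 <_) (sym (gcd-cong-% {K * 2 ^ e ∸ 1} X≡Y)) (cover (m%n<n e L))) m<X
  where
  e = suc n
  positive : ∀ {a} → 0 < a → ∀ d → 0 < a * 2 ^ d
  positive {a} 0<a d = ≤-trans 0<a (m≤m*n a (2 ^ d) {{m^n≢0 2 d}})
  X≡Y : (K * 2 ^ e ∸ 1) % m ≡ (k * 2 ^ (e % L) ∸ 1) % m
  X≡Y = %-pred-cong (positive (≤-<-trans z≤n m<K) e) (positive 0<k (e % L))
                    (%-*-cong K≡k (^-%-periodic 2 2^L≡1 e))
  K<K*2^e : K < K * 2 ^ e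
  K<K*2^e = m<m*n K (2 ^ e) {{>-nonZero (≤-<-trans z≤n m<K)}} (*-monoʳ-≤ 2 (m^n>0 2 n))
  m<X : m < K * 2 ^ e ∸ 1
  m<X = <-≤-trans m<K (<⇒≤pred K<K*2^e)

M : ℕ
M = 5592405

riesel-of-covered-residue : ∀ {t 𝔱} → 0 < t → t % 2730 ≡ 𝔱 → M < 659 * repunit 4096 𝔱 →
                            Covering M 24 (659 * repunit 4096 𝔱) → Riesel (659 * repunit 4096 t)
riesel-of-covered-residue {t} {𝔱} 0<t t≡𝔱 M<k cover =
  ¬2∣[1+a*2]*repunit[b*2] 329 2048 0<t , covering⇒composite {M} {24} refl cover (≤-<-trans z≤n M<k) K≡k M<K
  where
  R≡ : repunit 4096 t % M ≡ repunit 4096 𝔱 % M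
  R≡ = trans (repunit-%-periodic 4096 {2730} {M} refl refl t) (cong (λ s → repunit 4096 s % M) t≡𝔱)
  K≡k : 659 * repunit 4096 t % M ≡ 659 * repunit 4096 𝔱 % M
  K≡k = %-*-cong {659} {659} {repunit 4096 t} {repunit 4096 𝔱} refl R≡
  M<K : M < 659 * repunit 4096 t
  M<K = <-≤-trans M<k (*-monoʳ-≤ 659 (repunit-mono-≤ 4096 (subst (_≤ t) t≡𝔱 (m%n≤m t 2730))))

2^[2+digits₂659]≡4096 : 2 ^ (2 + digits₂ 659) ≡ 4096
2^[2+digits₂659]≡4096 = refl

repstring₂659≡659*repunit4096 : ∀ t → repstring₂ 659 2 t ≡ 659 * repunit 4096 t
repstring₂659≡659*repunit4096 t =
  trans (repstring₂≡*repunit 659 2 t) (cong (λ b → 659 * repunit b t) 2^[2+digits₂659]≡4096)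

theorem4p4 : (t : ℕ) → .{{_ : NonZero t}} →
    (t % 2730 ≡ 1369) ⊎ (t % 2730 ≡ 2599) →
    Riesel (repstring₂ 659 2 t)
theorem4p4 t residue = subst Riesel (sym (repstring₂659≡659*repunit4096 t)) (riesel residue)
  where
  riesel : (t % 2730 ≡ 1369) ⊎ (t % 2730 ≡ 2599) → Riesel (659 * repunit 4096 t)
  riesel (inj₁ t≡1369) = riesel-of-covered-residue (>-nonZero⁻¹ t) t≡1369
    (from-yes (M <? 659 * repunit 4096 1369)) (from-yes (covering? M 24 (659 * repunit 4096 1369)))
  riesel (inj₂ t≡2599) = riesel-of-covered-residue (>-nonZero⁻¹ t) t≡2599
    (from-yes (M <? 659 * repunit 4096 2599)) (from-yes (covering? M 24 (659 * repunit 4096 2599)))
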